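{- Let $G$ be a simple cubic graph with $G\ne K_4$. If $\mathcal C$ is a $4$-cycle of $G$, then $\mathcal C$ is a facial cycle in every polyhedral embedding of $G$.
   Context: An embedding of a graph in a surface without boundary is polyhedral if every facial walk (boundary walk of a face) is a cycle and any two distinct facial cycles intersect in either the empty set, a single vertex, or a single edge. -}

module Defs where

open import Data.Nat using (ℕ; zero; suc; _<_; _≤_)
open import Data.Fin using (Fin)
open import Data.Fin.Subset using (Subset; ∣_∣)
open import Data.Vec using (tabulate)
open import Data.Bool using (Bool; true; false; if_then_else_; _xor_)
open import Data.Product using (Σ; ∃; _×_; _,_; proj₁; proj₂)
open import Data.Sum using (_⊎_)
open import Relation.Binary.PropositionalEquality using (_≡_; _≢_)
open import Relation.Nullary using (¬_)
open import Data.Empty using (⊥)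

record Graph (n : ℕ) : Set where
  field
    adj    : Fin n → Fin n → Bool
    adj-sym    : ∀ u v → adj u v ≡ adj v u
    adj-irrefl : ∀ v → adj v v ≡ false

module _ {n : ℕ} (G : Graph n) where

  Adj : Fin n → Fin n → Set
  Adj u v = Graph.adj G u v ≡ true

  Nbhd : Fin n → Subset n
  Nbhd v = tabulate (Graph.adj G v)

  Cubic : Set
  Cubic = ∀ v → ∣ Nbhd v ∣ ≡ 3

  data Reach : Fin n → Fin n → Set where
    here  : ∀ {v} → Reach v v
    there : ∀ {u v w} → Adj u v → Reach v w → Reach u w

  Connected : Set
  Connected = ∀ u v → Reach u v

  IsK4 : Set
  IsK4 = (n ≡ 4) × (∀ u v → u ≢ v → Adj u v)

  FourCycle : Fin n → Fin n → Fin n → Fin n → Set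
  FourCycle a b c d =
    (a ≢ b) × (a ≢ c) × (a ≢ d) × (b ≢ c) × (b ≢ d) × (c ≢ d) ×
    Adj a b × Adj b c × Adj c d × Adj d a

iter : ∀ {A : Set} → (A → A) → ℕ → A → A
iter f zero    x = x
iter f (suc k) x = f (iter f k x)

_⟺_ : Set → Set → Set
P ⟺ Q = (P → Q) × (Q → P)

-- the undirected edge {a,b} read as an ordered pair (x,y)
UEdge : ∀ {n} → Fin n → Fin n → Fin n → Fin n → Set
UEdge a b x y = ((x ≡ a) × (y ≡ b)) ⊎ ((x ≡ b) × (y ≡ a))

-- Embedding schemes (rotation system + edge signature), which describe
-- exactly the cellular embeddings of G in (orientable or non-orientable)
-- surfaces without boundary.

record EmbeddingScheme {n : ℕ} (G : Graph n) : Set where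
  field
    rot  : Fin n → Fin n → Fin n
    rot⁻ : Fin n → Fin n → Fin n
    rot-adj  : ∀ v w → Adj G v w → Adj G v (rot v w)
    rot⁻-adj : ∀ v w → Adj G v w → Adj G v (rot⁻ v w)
    rot-rot⁻ : ∀ v w → Adj G v w → rot v (rot⁻ v w) ≡ w
    rot⁻-rot : ∀ v w → Adj G v w → rot⁻ v (rot v w) ≡ w
    rot-cyclic : ∀ v w u → Adj G v w → Adj G v u → ∃ λ k → iter (rot v) k w ≡ u
    -- edge signature: true = twisted edge (sign -1)
    sig     : Fin n → Fin n → Bool
    sig-sym : ∀ u v → sig u v ≡ sig v u

module _ {n : ℕ} {G : Graph n} (E : EmbeddingScheme G) where
  open EmbeddingScheme E

  -- a face-tracing state: traversing the edge u → v, with current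
  -- local orientation ε (false = +1, true = -1)
  State : Set
  State = Fin n × Fin n × Bool

  step : State → State
  step (u , v , ε) =
    let ε' = ε xor sig u v in
    (v , (if ε' then rot⁻ v u else rot v u) , ε')

  record FacialWalk : Set where
    field
      start  : State
      start-adj : Adj G (proj₁ start) (proj₁ (proj₂ start))
      len    : ℕ
      len>0  : 0 < len
      closed : iter step len start ≡ start
      minimal : ∀ j → 0 < j → j < len → iter step j start ≢ start

    vtx : ℕ → Fin n
    vtx i = proj₁ (iter step i start)

    VertexIn : Fin n → Set
    VertexIn x = Σ ℕ λ i → (i < len) × (vtx i ≡ x)

    EdgeIn : Fin n → Fin n → Set
    EdgeIn x y = Σ ℕ λ i → (i < len) × UEdge (vtx i) (vtx (suc i)) x y

    IsCycle : Set
    IsCycle = (3 ≤ len) × (∀ i j → i < j → j < len → vtx i ≢ vtx j)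

  open FacialWalk public

  SameCycle : FacialWalk → FacialWalk → Set
  SameCycle W W' = ∀ x y → EdgeIn W x y ⟺ EdgeIn W' x y

  -- C ∩ D is empty, a single vertex, or a single edge
  NiceIntersection : FacialWalk → FacialWalk → Set
  NiceIntersection W W' =
    (∀ x y z → x ≢ y → x ≢ z → y ≢ z →
       VertexIn W x → VertexIn W y → VertexIn W z →
       VertexIn W' x → VertexIn W' y → VertexIn W' z → ⊥) ×
    (∀ x y → x ≢ y → VertexIn W x → VertexIn W y → VertexIn W' x → VertexIn W' y →
       EdgeIn W x y × EdgeIn W' x y)
    where
    open import Data.Empty renaming (⊥ to ⊥)

  Polyhedral : Set
  Polyhedral =
    (∀ (W : FacialWalk) → IsCycle W) ×
    (∀ (W W' : FacialWalk) → ¬ SameCycle W W' → NiceIntersection W W')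

  FacialFourCycle : Fin n → Fin n → Fin n → Fin n → Set
  FacialFourCycle a b c d =
    Σ FacialWalk λ W → IsCycle W ×
      (∀ x y → EdgeIn W x y ⟺
         (UEdge a b x y ⊎ UEdge b c x y ⊎ UEdge c d x y ⊎ UEdge d a x y))

module Submission where

-- The face-tracing map is injective on states traversing an edge, so by
-- finiteness every such state lies on a closed orbit, i.e. on a facial walk; and
-- at a vertex of degree three any two neighbours are consecutive in the rotation,
-- so every path x y z lies on some facial walk.  Take the face F through a b c and
-- the face H through c d a.  If F also uses the edges cd and da, then F is the
-- 4-cycle abcd.  Otherwise F and H are different facial cycles sharing a and c, so
-- by polyhedrality they share the edge ac.  The same applied to bcda gives either
-- the face bcda or the edge bd.  If both chords ac and bd exist, {a,b,c,d} is a
-- 4-clique, and in a connected cubic graph a 4-clique is the whole graph: G = K₄.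

open import Defs
open import Data.Nat using (ℕ; zero; suc; _+_; _*_; _∸_; _<_; _≤_; _≤?_; z≤n; s≤s)
open import Data.Nat.Properties
  using (≤-trans; ≤-refl; ≤-antisym; <⇒≤; ≤⇒≯; <-cmp; n<1+n; m≤n⇒m<n∨m≡n;
         m<n⇒0<n∸m; m+[n∸m]≡n; anyUpTo?)
open import Data.Nat.Induction using (<-rec)
open import Data.Fin as F using (Fin; toℕ)
open import Data.Fin.Properties using (pigeonhole; injective⇒≤; inj⇒≟; *↔×; 2↔Bool)
open import Data.Fin.Subset using (Subset; ∣_∣; ⊤; _-_) renaming (_∈_ to _∈ₛ_)
open import Data.Fin.Subset.Properties using (x∈p⇒∣p-x∣<∣p∣; x∈p∧x≢y⇒x∈p-y; ∈⊤; ∣⊤∣≡n)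
open import Data.Vec.Properties using (lookup∘tabulate; lookup⇒[]=)
open import Data.Bool using (Bool; true; false; if_then_else_; _xor_)
open import Data.Bool.Properties using (xor-assoc; xor-same; xor-identityʳ)
open import Data.List using (List; []; _∷_; length; lookup)
open import Data.List.Relation.Unary.All as All using (All; []; _∷_)
open import Data.List.Relation.Unary.All.Properties using (¬Any⇒All¬)
open import Data.List.Relation.Unary.Any using (here; there; index)
open import Data.List.Relation.Unary.Any.Properties using (lookup-index)
open import Data.List.Relation.Unary.AllPairs using (AllPairs; []; _∷_)
open import Data.List.Relation.Unary.Unique.Propositional using (Unique)
open import Data.List.Membership.Propositional using (_∈_)
open import Data.List.Relation.Binary.Sublist.Propositional using ([]; _∷_; _∷ʳ_)
open import Data.List.Relation.Binary.Sublist.Propositional.Properties using (Any-resp-⊆)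
open import Data.Product using (Σ; ∃; _×_; _,_; proj₁; proj₂)
open import Data.Product.Function.NonDependent.Propositional using (_×-↔_)
open import Data.Sum using (_⊎_; inj₁; inj₂; [_,_]′)
open import Data.Empty using (⊥-elim)
open import Function using (_∘_; id)
open import Function.Bundles using (_↣_; Injection)
open import Function.Properties.Inverse using (↔⇒↣; ↔-sym; ↔-refl)
open import Function.Construct.Composition using (_↔-∘_)
open import Relation.Nullary using (¬_; Dec; yes; no)
open import Relation.Nullary.Decidable using (_×-dec_; _⊎-dec_)
open import Relation.Unary using (Decidable)
open import Relation.Binary.PropositionalEquality
  using (_≡_; _≢_; refl; sym; trans; cong; subst; subst₂; ≢-sym)
open import Relation.Binary.Definitions using (tri<; tri≈; tri>)

distinct-members≤size : ∀ {n} {p : Subset n} (xs : List (Fin n)) →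
  Unique xs → All (_∈ₛ p) xs → length xs ≤ ∣ p ∣
distinct-members≤size [] _ _ = z≤n
distinct-members≤size {p = p} (x ∷ xs) (x∉xs ∷ distinct) (x∈p ∷ xs⊆p) =
  ≤-trans (s≤s (distinct-members≤size xs distinct (All.zipWith in-p-x (x∉xs , xs⊆p))))
          (x∈p⇒∣p-x∣<∣p∣ x∈p)
  where
  in-p-x : ∀ {y} → x ≢ y × y ∈ₛ p → y ∈ₛ p - x
  in-p-x (x≢y , y∈p) = x∈p∧x≢y⇒x∈p-y y∈p (≢-sym x≢y)

least-witness : ∀ {Q : ℕ → Set} → Decidable Q → ∀ {p} → Q p →
  ∃ λ m → Q m × (∀ j → j < m → ¬ Q j)
least-witness {Q} Q? {p} = <-rec (λ p → Q p → Least) search p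
  where
  Least : Set
  Least = ∃ λ m → Q m × (∀ j → j < m → ¬ Q j)
  search : ∀ p → (∀ {m} → m < p → Q m → Least) → Q p → Least
  search p smaller qp with anyUpTo? Q? p
  ... | yes (m , m<p , qm) = smaller m<p qm
  ... | no none            = p , qp , λ j j<p qj → none (j , j<p , qj)

fixed-orbit : ∀ {A : Set} (f : A → A) {x} → f x ≡ x → ∀ k → iter f k x ≡ x
fixed-orbit f fx≡x zero    = refl
fixed-orbit f fx≡x (suc k) = trans (cong f (fixed-orbit f fx≡x k)) fx≡x

two-orbit : ∀ {A : Set} (f : A → A) {x} → f (f x) ≡ x →
  ∀ k → iter f k x ≡ x ⊎ iter f k x ≡ f x
two-orbit f ffx≡x zero = inj₁ refl
two-orbit f ffx≡x (suc k) with two-orbit f ffx≡x k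
... | inj₁ at-x  = inj₂ (cong f at-x)
... | inj₂ at-fx = inj₁ (trans (cong f at-fx) ffx≡x)

-- A map f on a set injecting into a finite set, preserving a predicate P and
-- injective on P, is a permutation of P: every point of P returns to itself,
-- hence has a least positive period.
module InjectiveOrbits {A : Set} {m : ℕ} (code : A ↣ Fin m)
  (P : A → Set) (f : A → A)
  (f-pres : ∀ {x} → P x → P (f x))
  (f-inj  : ∀ {x y} → P x → P y → f x ≡ f y → x ≡ y) where

  iter-pres : ∀ {x} → P x → ∀ k → P (iter f k x)
  iter-pres px zero    = px
  iter-pres px (suc k) = f-pres (iter-pres px k)

  cancel : ∀ {x} → P x → ∀ i k → iter f i x ≡ iter f (i + k) x → x ≡ iter f k x
  cancel px zero    k eq = eq
  cancel px (suc i) k eq = cancel px i k (f-inj (iter-pres px i) (iter-pres px (i + k)) eq)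

  -- Two of the first m+1 iterates coincide (pigeonhole); cancelling gives a period.
  periodic : ∀ {x} → P x → ∃ λ p → 0 < p × iter f p x ≡ x
  periodic {x} px with pigeonhole (n<1+n m) (λ i → Injection.to code (iter f (toℕ i) x))
  ... | i , j , i<j , same-code =
    toℕ j ∸ toℕ i , m<n⇒0<n∸m i<j , sym (cancel px (toℕ i) (toℕ j ∸ toℕ i) same-iterate)
    where
    same-iterate : iter f (toℕ i) x ≡ iter f (toℕ i + (toℕ j ∸ toℕ i)) x
    same-iterate = trans (Injection.injective code same-code)
                         (cong (λ t → iter f t x) (sym (m+[n∸m]≡n (<⇒≤ i<j))))

  Returns : A → ℕ → Set
  Returns x j = 0 < j × iter f j x ≡ x

  least-period : ∀ {x} → P x → ∃ λ p → Returns x p × (∀ j → j < p → ¬ Returns x j)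
  least-period {x} px = least-witness returns? (proj₂ (periodic px))
    where
    returns? : Decidable (Returns x)
    returns? j = (1 ≤? j) ×-dec inj⇒≟ code (iter f j x) x

xor-undo : ∀ a c → (a xor c) xor c ≡ a
xor-undo a c = trans (xor-assoc a c c) (trans (cong (a xor_) (xor-same c)) (xor-identityʳ a))

xor-cancelʳ : ∀ c {a b} → a xor c ≡ b xor c → a ≡ b
xor-cancelʳ c {a} {b} eq = trans (sym (xor-undo a c)) (trans (cong (_xor c) eq) (xor-undo b c))

Adj-sym : ∀ {n} (G : Graph n) {u v} → Adj G u v → Adj G v u
Adj-sym G {u} {v} uv = trans (sym (Graph.adj-sym G u v)) uv

reach-closed : ∀ {n} {G : Graph n} (S : Fin n → Set) →
  (∀ {v w} → S v → Adj G v w → S w) → ∀ {u v} → Reach G u v → S u → S v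
reach-closed S step-closed here          su = su
reach-closed S step-closed (there uv rest) su = reach-closed S step-closed rest (step-closed su uv)

covering-list-bound : ∀ {n} (xs : List (Fin n)) → (∀ v → v ∈ xs) → n ≤ length xs
covering-list-bound xs covers = injective⇒≤ {f = λ v → index (covers v)} position-injective
  where
  position-injective : ∀ {u v} → index (covers u) ≡ index (covers v) → u ≡ v
  position-injective {u} {v} same =
    trans (lookup-index (covers u)) (trans (cong (lookup xs) same) (sym (lookup-index (covers v))))

clique-adj : ∀ {n} {G : Graph n} {xs : List (Fin n)} → AllPairs (Adj G) xs →
  ∀ {u v} → u ∈ xs → v ∈ xs → u ≢ v → Adj G u v
clique-adj (_ ∷ _) (here refl) (here refl) u≢v = ⊥-elim (u≢v refl)
clique-adj (adj-head ∷ _) (here refl) (there v∈) _ = All.lookup adj-head v∈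
clique-adj {G = G} (adj-head ∷ _) (there u∈) (here refl) _ = Adj-sym G (All.lookup adj-head u∈)
clique-adj {G = G} (_ ∷ rest) (there u∈) (there v∈) u≢v = clique-adj {G = G} rest u∈ v∈ u≢v

module CubicGraph {n : ℕ} (G : Graph n) (cubic : Cubic G) where
  open import Data.List.Membership.DecPropositional (F._≟_ {n}) using (_∈?_)

  neighbours≤3 : ∀ {v} (ys : List (Fin n)) → Unique ys → All (Adj G v) ys → length ys ≤ 3
  neighbours≤3 {v} ys distinct adjacent =
    subst (length ys ≤_) (cubic v) (distinct-members≤size ys distinct (All.map in-Nbhd adjacent))
    where
    in-Nbhd : ∀ {w} → Adj G v w → w ∈ₛ Nbhd G v
    in-Nbhd {w} vw = lookup⇒[]= w _ (trans (lookup∘tabulate (Graph.adj G v) w) vw)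

  only-neighbours : ∀ {v p q r w} → p ≢ q → p ≢ r → q ≢ r →
    Adj G v p → Adj G v q → Adj G v r → Adj G v w → w ∈ p ∷ q ∷ r ∷ []
  only-neighbours {p = p} {q} {r} {w} p≢q p≢r q≢r vp vq vr vw with w ∈? p ∷ q ∷ r ∷ []
  ... | yes w∈ = w∈
  ... | no w∉ = ⊥-elim (≤⇒≯ (neighbours≤3 (w ∷ p ∷ q ∷ r ∷ []) distinct (vw ∷ vp ∷ vq ∷ vr ∷ [])) ≤-refl)
    where
    distinct : Unique (w ∷ p ∷ q ∷ r ∷ [])
    distinct = ¬Any⇒All¬ _ w∉ ∷ (p≢q ∷ p≢r ∷ []) ∷ (q≢r ∷ []) ∷ [] ∷ []

  module Scheme (E : EmbeddingScheme G) where
    open EmbeddingScheme E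

    turn : Fin n → Fin n → Bool → Fin n
    turn v u b = if b then rot⁻ v u else rot v u

    turn-adj : ∀ v u b → Adj G v u → Adj G v (turn v u b)
    turn-adj v u true  vu = rot⁻-adj v u vu
    turn-adj v u false vu = rot-adj v u vu

    turn-injective : ∀ {v u u'} b → Adj G v u → Adj G v u' → turn v u b ≡ turn v u' b → u ≡ u'
    turn-injective {v} {u} {u'} true vu vu' eq =
      trans (sym (rot-rot⁻ v u vu)) (trans (cong (rot v) eq) (rot-rot⁻ v u' vu'))
    turn-injective {v} {u} {u'} false vu vu' eq =
      trans (sym (rot⁻-rot v u vu)) (trans (cong (rot⁻ v) eq) (rot⁻-rot v u' vu'))

    -- Otherwise x, π x, π⁻¹ x
    -- and z would be four distinct neighbours.
    consecutive : ∀ {y x z} → Adj G y x → Adj G y z → x ≢ z → ∃ λ b → turn y x b ≡ z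
    consecutive {y} {x} {z} yx yz x≢z with rot y x F.≟ z | rot⁻ y x F.≟ z
    ... | yes next≡z | _           = false , next≡z
    ... | no _       | yes prev≡z  = true , prev≡z
    ... | no next≢z  | no prev≢z   =
      ⊥-elim (≤⇒≯ (neighbours≤3 (x ∷ next ∷ prev ∷ z ∷ []) distinct
                     (yx ∷ rot-adj y x yx ∷ rot⁻-adj y x yx ∷ yz ∷ [])) ≤-refl)
      where
      next prev : Fin n
      next = rot y x
      prev = rot⁻ y x
      z-on-orbit : ∃ λ k → iter (rot y) k x ≡ z
      z-on-orbit = rot-cyclic y x z yx yz
      x≢next : x ≢ next
      x≢next x≡next =
        x≢z (trans (sym (fixed-orbit (rot y) (sym x≡next) (proj₁ z-on-orbit))) (proj₂ z-on-orbit))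
      x≢prev : x ≢ prev
      x≢prev x≡prev = x≢next (sym (trans (cong (rot y) x≡prev) (rot-rot⁻ y x yx)))
      next≢prev : next ≢ prev
      next≢prev next≡prev with two-orbit (rot y) (trans (cong (rot y) next≡prev) (rot-rot⁻ y x yx))
                                         (proj₁ z-on-orbit)
      ... | inj₁ at-x    = x≢z (trans (sym at-x) (proj₂ z-on-orbit))
      ... | inj₂ at-next = next≢z (trans (sym at-next) (proj₂ z-on-orbit))
      distinct : Unique (x ∷ next ∷ prev ∷ z ∷ [])
      distinct = (x≢next ∷ x≢prev ∷ x≢z ∷ []) ∷ (next≢prev ∷ next≢z ∷ []) ∷ (prev≢z ∷ []) ∷ [] ∷ []

    Proper : State E → Set
    Proper s = Adj G (proj₁ s) (proj₁ (proj₂ s))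

    step-proper : ∀ {s} → Proper s → Proper (step E s)
    step-proper {u , v , ε} uv = turn-adj v u (ε xor sig u v) (Adj-sym G uv)

    -- Face tracing is injective on proper states: the traversed edge, the sign
    -- and the rotation at the current vertex determine the previous state.
    step-injective : ∀ {s t} → Proper s → Proper t → step E s ≡ step E t → s ≡ t
    step-injective {u , v , ε} {u' , v' , ε'} uv u'v' eq
      with cong proj₁ eq | cong (proj₂ ∘ proj₂) eq | cong (proj₁ ∘ proj₂) eq
    ... | refl | same-sign | same-turn
      with turn-injective (ε xor sig u v) (Adj-sym G uv) (Adj-sym G u'v')
             (trans same-turn (cong (turn v u') (sym same-sign)))
    ... | refl = cong (λ b → u , v , b) (xor-cancelʳ (sig u v) same-sign)

    state-code : State E ↣ Fin (n * (n * 2))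
    state-code = ↔⇒↣ (↔-sym ((↔-refl ×-↔ (↔-refl ×-↔ 2↔Bool)) ↔-∘ ((↔-refl ×-↔ *↔×) ↔-∘ *↔×)))

    open InjectiveOrbits state-code Proper (step E) (λ {s} → step-proper {s})
      (λ {s} {t} → step-injective {s} {t})

    facial-walk : ∀ s → Proper s → Σ (FacialWalk E) λ W → start W ≡ s
    facial-walk s proper with least-period proper
    ... | p , (p>0 , returns) , shorter =
      record { start = s ; start-adj = proper ; len = p ; len>0 = p>0 ; closed = returns
             ; minimal = λ j j>0 j<p back → shorter j j<p (j>0 , back) } , refl

    face-through : ∀ {x y z} → Adj G x y → Adj G y z → x ≢ z →
      Σ (FacialWalk E) λ W → vtx W 0 ≡ x × vtx W 1 ≡ y × vtx W 2 ≡ z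
    face-through {x} {y} {z} xy yz x≢z with consecutive (Adj-sym G xy) yz x≢z
    ... | b , turn≡z with facial-walk (x , y , b xor sig x y) xy
    ...   | W , starts =
      W , cong proj₁ starts , cong (proj₁ ∘ step E) starts ,
      trans (cong (proj₁ ∘ step E ∘ step E) starts)
            (trans (cong (turn y x) (xor-undo b (sig x y))) turn≡z)

    walk-adj : (W : FacialWalk E) → ∀ i → Adj G (vtx W i) (vtx W (suc i))
    walk-adj W = iter-pres (start-adj W)

    edge-adj : (W : FacialWalk E) → ∀ {x y} → EdgeIn W x y → Adj G x y
    edge-adj W (i , _ , inj₁ (x≡ , y≡)) = subst₂ (Adj G) (sym x≡) (sym y≡) (walk-adj W i)
    edge-adj W (i , _ , inj₂ (x≡ , y≡)) = Adj-sym G (subst₂ (Adj G) (sym y≡) (sym x≡) (walk-adj W i))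

    edge? : (W : FacialWalk E) → ∀ x y → Dec (EdgeIn W x y)
    edge? W x y = anyUpTo? traverses? (len W)
      where
      traverses? : ∀ i → Dec (UEdge (vtx W i) (vtx W (suc i)) x y)
      traverses? i = ((x F.≟ vtx W i) ×-dec (y F.≟ vtx W (suc i)))
                 ⊎-dec ((x F.≟ vtx W (suc i)) ×-dec (y F.≟ vtx W i))

    square-edges : ∀ (W : FacialWalk E) {a b c d} → len W ≡ 4 →
      vtx W 0 ≡ a → vtx W 1 ≡ b → vtx W 2 ≡ c → vtx W 3 ≡ d → vtx W 4 ≡ a →
      ∀ x y → EdgeIn W x y ⟺ (UEdge a b x y ⊎ UEdge b c x y ⊎ UEdge c d x y ⊎ UEdge d a x y)
    square-edges W {a} {b} {c} {d} len≡4 v0 v1 v2 v3 v4 x y = edge-of-square , square-edge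
      where
      moved : ∀ {p q p' q'} → p ≡ p' → q ≡ q' → UEdge p q x y → UEdge p' q' x y
      moved refl refl e = e
      edge-of-square : EdgeIn W x y → UEdge a b x y ⊎ UEdge b c x y ⊎ UEdge c d x y ⊎ UEdge d a x y
      edge-of-square (i , i<len , e) with subst (i <_) len≡4 i<len
      ... | s≤s z≤n                   = inj₁ (moved v0 v1 e)
      ... | s≤s (s≤s z≤n)             = inj₂ (inj₁ (moved v1 v2 e))
      ... | s≤s (s≤s (s≤s z≤n))       = inj₂ (inj₂ (inj₁ (moved v2 v3 e)))
      ... | s≤s (s≤s (s≤s (s≤s z≤n))) = inj₂ (inj₂ (inj₂ (moved v3 v4 e)))
      at : ∀ i → i < 4 → i < len W
      at i i<4 = subst (i <_) (sym len≡4) i<4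
      square-edge : UEdge a b x y ⊎ UEdge b c x y ⊎ UEdge c d x y ⊎ UEdge d a x y → EdgeIn W x y
      square-edge (inj₁ e)                = 0 , at 0 (s≤s z≤n) , moved (sym v0) (sym v1) e
      square-edge (inj₂ (inj₁ e))         = 1 , at 1 (s≤s (s≤s z≤n)) , moved (sym v1) (sym v2) e
      square-edge (inj₂ (inj₂ (inj₁ e)))  = 2 , at 2 (s≤s (s≤s (s≤s z≤n))) , moved (sym v2) (sym v3) e
      square-edge (inj₂ (inj₂ (inj₂ e)))  = 3 , at 3 ≤-refl , moved (sym v3) (sym v4) e

    module OnCycle (W : FacialWalk E) (cycle : IsCycle W) where

      vtx-injective : ∀ {i j} → i < len W → j < len W → vtx W i ≡ vtx W j → i ≡ j
      vtx-injective {i} {j} i<len j<len same with <-cmp i j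
      ... | tri< i<j _ _ = ⊥-elim (proj₂ cycle i j i<j j<len same)
      ... | tri≈ _ i≡j _ = i≡j
      ... | tri> _ _ j<i = ⊥-elim (proj₂ cycle j i j<i i<len (sym same))

      wraps : vtx W (len W) ≡ vtx W 0
      wraps = cong proj₁ (closed W)

      cycle-neighbours : ∀ {i w} → suc i < len W → EdgeIn W (vtx W (suc i)) w →
        w ≡ vtx W (suc (suc i)) ⊎ w ≡ vtx W i
      cycle-neighbours si<len (j , j<len , inj₁ (at-j , w≡))
        with vtx-injective si<len j<len at-j
      ... | refl = inj₁ w≡
      cycle-neighbours si<len (j , j<len , inj₂ (at-sj , w≡))
        with m≤n⇒m<n∨m≡n j<len
      ... | inj₁ sj<len with vtx-injective si<len sj<len at-sj
      ...   | refl = inj₂ w≡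
      cycle-neighbours si<len (j , j<len , inj₂ (at-sj , w≡)) | inj₂ sj≡len
        with vtx-injective si<len (len>0 W) (trans at-sj (trans (cong (vtx W) sj≡len) wraps))
      ... | ()

      -- A facial cycle starting a b c and using the edges cd and da is the
      -- 4-cycle abcd: the edges force v₃ = d, v₄ = a, and then length 4.
      closes-as-square : ∀ {a b c d} → a ≢ c → b ≢ d → d ≢ a →
        vtx W 0 ≡ a → vtx W 1 ≡ b → vtx W 2 ≡ c → EdgeIn W c d → EdgeIn W d a →
        FacialFourCycle E a b c d
      closes-as-square {a} {b} {c} {d} a≢c b≢d d≢a v0 v1 v2 cd∈W da∈W =
        W , cycle , square-edges W len≡4 v0 v1 v2 v3 v4
        where
        v3 : vtx W 3 ≡ d
        v3 = [ sym , (λ d≡v1 → ⊥-elim (b≢d (trans (sym v1) (sym d≡v1)))) ]′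
               (cycle-neighbours (proj₁ cycle) (subst (λ u → EdgeIn W u d) (sym v2) cd∈W))
        3<len : 3 < len W
        3<len with m≤n⇒m<n∨m≡n (proj₁ cycle)
        ... | inj₁ 3<len = 3<len
        ... | inj₂ 3≡len = ⊥-elim (d≢a (trans (sym v3) (trans (cong (vtx W) 3≡len) (trans wraps v0))))
        v4 : vtx W 4 ≡ a
        v4 = [ sym , (λ a≡v2 → ⊥-elim (a≢c (trans a≡v2 v2))) ]′
               (cycle-neighbours 3<len (subst (λ u → EdgeIn W u a) (sym v3) da∈W))
        len≡4 : len W ≡ 4
        len≡4 with m≤n⇒m<n∨m≡n 3<len
        ... | inj₂ 4≡len = sym 4≡len
        ... | inj₁ 4<len with vtx-injective 4<len (len>0 W) (trans v4 (sym v0))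
        ...   | ()

    shared-vertices-adjacent : Polyhedral E → (W W' : FacialWalk E) → ¬ SameCycle E W W' →
      ∀ {x y} → x ≢ y → VertexIn W x → VertexIn W y → VertexIn W' x → VertexIn W' y → Adj G x y
    shared-vertices-adjacent (_ , nice) W W' W≠W' x≢y x∈W y∈W x∈W' y∈W' =
      edge-adj W (proj₁ (proj₂ (nice W W' W≠W') _ _ x≢y x∈W y∈W x∈W' y∈W'))

    -- Compare the faces F ∋ abc and H ∋ cda: if F
    -- misses cd or da, then F ≠ H, and they share a and c, hence the edge ac.
    facial-or-chord : Polyhedral E → ∀ {a b c d} → a ≢ c → b ≢ d → d ≢ a →
      Adj G a b → Adj G b c → Adj G c d → Adj G d a → FacialFourCycle E a b c d ⊎ Adj G a c
    facial-or-chord pol@(cycles , _) {a} {b} {c} {d} a≢c b≢d d≢a ab bc cd da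
      with face-through ab bc a≢c | face-through cd da (≢-sym a≢c)
    ... | F , f0 , f1 , f2 | H , h0 , h1 , h2 with edge? F c d ×-dec edge? F d a
    ...   | yes (cd∈F , da∈F) =
      inj₁ (OnCycle.closes-as-square F (cycles F) a≢c b≢d d≢a f0 f1 f2 cd∈F da∈F)
    ...   | no F-misses =
      inj₂ (shared-vertices-adjacent pol F H F≠H a≢c
              (0 , len>0 F , f0) (2 , proj₁ (cycles F) , f2) (2 , proj₁ (cycles H) , h2) (0 , len>0 H , h0))
      where
      F≠H : ¬ SameCycle E F H
      F≠H same = F-misses (proj₂ (same c d) (0 , len>0 H , inj₁ (sym h0 , sym h1)) ,
                           proj₂ (same d a) (1 , ≤-trans (s≤s (s≤s z≤n)) (proj₁ (cycles H)) , inj₁ (sym h1 , sym h2)))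

  -- A connected cubic graph containing a 4-clique is K₄: the clique is closed
  -- under adjacency (each member already has its three neighbours in it), so by
  -- connectivity it is the whole vertex set.
  clique-is-K4 : Connected G → ∀ {a b c d} →
    Unique (a ∷ b ∷ c ∷ d ∷ []) → AllPairs (Adj G) (a ∷ b ∷ c ∷ d ∷ []) → IsK4 G
  clique-is-K4 connected {a} {b} {c} {d}
    distinct@((a≢b ∷ a≢c ∷ a≢d ∷ []) ∷ (b≢c ∷ b≢d ∷ []) ∷ (c≢d ∷ []) ∷ [] ∷ [])
    clique@((ab ∷ ac ∷ ad ∷ []) ∷ (bc ∷ bd ∷ []) ∷ (cd ∷ []) ∷ [] ∷ []) =
    ≤-antisym (covering-list-bound quad spans) (subst (4 ≤_) (∣⊤∣≡n n) four-in-⊤) ,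
    λ u v u≢v → clique-adj {G = G} clique (spans u) (spans v) u≢v
    where
    quad : List (Fin n)
    quad = a ∷ b ∷ c ∷ d ∷ []
    adjacency-closed : ∀ {v w} → v ∈ quad → Adj G v w → w ∈ quad
    adjacency-closed (here refl) vw = there (only-neighbours b≢c b≢d c≢d ab ac ad vw)
    adjacency-closed (there (here refl)) vw =
      Any-resp-⊆ (refl ∷ (b ∷ʳ (refl ∷ refl ∷ [])))
        (only-neighbours a≢c a≢d c≢d (Adj-sym G ab) bc bd vw)
    adjacency-closed (there (there (here refl))) vw =
      Any-resp-⊆ (refl ∷ refl ∷ (c ∷ʳ (refl ∷ [])))
        (only-neighbours a≢b a≢d b≢d (Adj-sym G ac) (Adj-sym G bc) cd vw)
    adjacency-closed (there (there (there (here refl)))) vw =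
      Any-resp-⊆ (refl ∷ refl ∷ refl ∷ (d ∷ʳ []))
        (only-neighbours a≢b a≢c b≢c (Adj-sym G ad) (Adj-sym G bd) (Adj-sym G cd) vw)
    spans : ∀ v → v ∈ quad
    spans v = reach-closed (_∈ quad) adjacency-closed (connected a v) (here refl)
    four-in-⊤ : 4 ≤ ∣ ⊤ {n} ∣
    four-in-⊤ = distinct-members≤size quad distinct (All.universal (λ _ → ∈⊤) quad)

rotate : ∀ {n} {G : Graph n} {E : EmbeddingScheme G} {a b c d : Fin n} →
  FacialFourCycle E b c d a → FacialFourCycle E a b c d
rotate (W , cycle , edges) =
  W , cycle , λ x y → shift ∘ proj₁ (edges x y) , proj₂ (edges x y) ∘ unshift
  where
  shift : ∀ {A B C D : Set} → A ⊎ B ⊎ C ⊎ D → D ⊎ A ⊎ B ⊎ C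
  shift (inj₁ e)               = inj₂ (inj₁ e)
  shift (inj₂ (inj₁ e))        = inj₂ (inj₂ (inj₁ e))
  shift (inj₂ (inj₂ (inj₁ e))) = inj₂ (inj₂ (inj₂ e))
  shift (inj₂ (inj₂ (inj₂ e))) = inj₁ e
  unshift : ∀ {A B C D : Set} → D ⊎ A ⊎ B ⊎ C → A ⊎ B ⊎ C ⊎ D
  unshift (inj₁ e)               = inj₂ (inj₂ (inj₂ e))
  unshift (inj₂ (inj₁ e))        = inj₁ e
  unshift (inj₂ (inj₂ (inj₁ e))) = inj₂ (inj₁ e)
  unshift (inj₂ (inj₂ (inj₂ e))) = inj₂ (inj₂ (inj₁ e))

proposition6 : ∀ {n : ℕ} (G : Graph n) → Connected G → Cubic G → ¬ IsK4 G →
    ∀ (a b c d : Fin n) → FourCycle G a b c d →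
    (E : EmbeddingScheme G) → Polyhedral E → FacialFourCycle E a b c d
proposition6 G connected cubic not-K4 a b c d (a≢b , a≢c , a≢d , b≢c , b≢d , c≢d , ab , bc , cd , da) E pol =
  [ id , (λ ac → [ rotate , (λ bd → ⊥-elim (not-K4 (K4-from-chords ac bd))) ]′ bcda-facial-or-bd) ]′
    abcd-facial-or-ac
  where
  open CubicGraph G cubic
  open Scheme E
  abcd-facial-or-ac : FacialFourCycle E a b c d ⊎ Adj G a c
  abcd-facial-or-ac = facial-or-chord pol a≢c b≢d (≢-sym a≢d) ab bc cd da
  bcda-facial-or-bd : FacialFourCycle E b c d a ⊎ Adj G b d
  bcda-facial-or-bd = facial-or-chord pol b≢d (≢-sym a≢c) a≢b bc cd da ab
  K4-from-chords : Adj G a c → Adj G b d → IsK4 G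
  K4-from-chords ac bd = clique-is-K4 connected
    ((a≢b ∷ a≢c ∷ a≢d ∷ []) ∷ (b≢c ∷ b≢d ∷ []) ∷ (c≢d ∷ []) ∷ [] ∷ [])
    ((ab ∷ ac ∷ Adj-sym G da ∷ []) ∷ (bc ∷ bd ∷ []) ∷ (cd ∷ []) ∷ [] ∷ [])
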